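{- Let $A,B$ be real $d\times d$ matrices. Let $\tilde\Gamma:\mathbb R^{d\times d}\to\mathbb R^{d^2}$ be a fixed linear bijection (embedding matrices as vectors) with inverse $\Gamma$. In $\mathbb R^{3d^2+2}$ let $R_A=[1,d^2]$, $R_B=[d^2+1,2d^2]$, $R_C=[2d^2+1,3d^2]$, $i=3d^2+1$, $j=3d^2+2$, and for a vector $v$ and a range $R$ let $v_R$ be the subvector of entries with indices in $R$. Define $s\in\mathbb R^{3d^2+2}$ by $s_{R_A}=\tilde\Gamma(A)$, $s_{R_B}=\tilde\Gamma(B)$, $s_{R_C}=0$, $s_i=1$, $s_j=0$, and define the bilinear map $*:\mathbb R^{3d^2+2}\times\mathbb R^{3d^2+2}\to\mathbb R^{3d^2+2}$ by $(x*y)_{R_A}=(x*y)_{R_B}=0$, $(x*y)_{R_C}=\tilde\Gamma(\Gamma(x_{R_C})\Gamma(y_{R_C}))+x_j\,y_{R_A}+y_j\,x_{R_B}$, $(x*y)_i=0$, $(x*y)_j=x_iy_i$. For a vector $v$ obtained from a combination of $n$ instances of $s$, write $\bar v=v_{R_C}$. Then: (1) if $n$ is not divisible by $3$, then $\bar v=0$; (2) if $n=3m$ ($m\ge1$) and $\bar v\ne0$, then $\Gamma(\bar v)=M_1M_2\cdots M_m$ for some $M_1,\dots,M_m\in\{A,B\}$; (3) for every $m\ge1$ and every $M_1,\dots,M_m\in\{A,B\}$ there is a combination of $3m$ instances of $s$ whose value $v$ satisfies $\Gamma(\bar v)=M_1\cdots M_m$; (4) if $n=3m$ and every subcombination of the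 combination has either fewer than $3$ instances of $s$ or a number of instances of $s$ divisible by $3$, then $\Gamma(\bar v)$ is a product of $m$ matrices from $\{A,B\}$.
   Context: A combination of $n$ instances of $s$ is defined recursively: for $n=1$ the only combination is $s$; for $n\ge 2$ the combinations are the expressions $X*Y$ where $X$ is a combination of $n_1$ instances and $Y$ a combination of $n_2$ instances of $s$, with $n_1,n_2\ge1$, $n_1+n_2=n$. Each combination evaluates to a vector. A subcombination is any sub-expression appearing within a matching pair of brackets in this recursive construction (i.e. any $X$ or $Y$ arising at some level of the recursion). -}

module Defs where

open import Level using (Level; _⊔_)
open import Algebra.Bundles using (CommutativeRing)
open import Data.Nat using (ℕ; zero; suc; _+_; _<_)
import Data.Nat as ℕ
open import Data.Nat.Divisibility using (_∣_)
open import Data.Fin using (Fin; _↑ˡ_; _↑ʳ_)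
import Data.Fin as Fin
open import Data.Bool using (Bool; true; false)
open import Data.Vec using (Vec; []; _∷_)
open import Data.Vec.Functional using (Vector)
import Data.Vec.Functional as VF
open import Data.Product using (_×_; Σ)
open import Data.Sum using (_⊎_)
open import Relation.Nullary using (¬_)

-- Combinations of n instances of s: binary trees with n leaves.
data Comb : ℕ → Set where
  leaf : Comb 1
  node : ∀ {n₁ n₂} → Comb n₁ → Comb n₂ → Comb (n₁ + n₂)

SizeOK : ℕ → Set
SizeOK n = n < 3 ⊎ 3 ∣ n

data Good : ∀ {n} → Comb n → Set where
  good-leaf : Good leaf
  good-node : ∀ {n₁ n₂} {X : Comb n₁} {Y : Comb n₂} →
              SizeOK n₁ → SizeOK n₂ → Good X → Good Y → Good (node X Y)

module Construction {c ℓ : Level} (R : CommutativeRing c ℓ) (d : ℕ) where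
  open CommutativeRing R hiding (_+_; _*_)
  open CommutativeRing R using () renaming (_+_ to _+ᵣ_; _*_ to _*ᵣ_)

  Mat : Set c
  Mat = Fin d → Fin d → Carrier

  D : ℕ
  D = d ℕ.* d

  N : ℕ
  N = D ℕ.+ (D ℕ.+ (D ℕ.+ 2))

  _≈v_ : ∀ {k} → Vector Carrier k → Vector Carrier k → Set ℓ
  u ≈v w = ∀ i → u i ≈ w i

  _≈m_ : Mat → Mat → Set ℓ
  M ≈m M' = ∀ i j → M i j ≈ M' i j

  0v : ∀ {k} → Vector Carrier k
  0v _ = 0#

  _+v_ : ∀ {k} → Vector Carrier k → Vector Carrier k → Vector Carrier k
  (u +v w) i = u i +ᵣ w i

  _·v_ : ∀ {k} → Carrier → Vector Carrier k → Vector Carrier k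
  (a ·v w) i = a *ᵣ w i

  _+m_ : Mat → Mat → Mat
  (M +m M') i j = M i j +ᵣ M' i j

  _·m_ : Carrier → Mat → Mat
  (a ·m M) i j = a *ᵣ M i j

  Σ[<_]_ : (k : ℕ) → (Fin k → Carrier) → Carrier
  Σ[< zero ] f = 0#
  Σ[< suc k ] f = f Fin.zero +ᵣ Σ[< k ] (λ i → f (Fin.suc i))

  _⊗_ : Mat → Mat → Mat
  (M ⊗ M') i j = Σ[< d ] (λ k → M i k *ᵣ M' k j)

  record IsLinearBijection (Γ̃ : Mat → Vector Carrier D) (Γ : Vector Carrier D → Mat) : Set (c ⊔ ℓ) where
    field
      Γ̃-cong   : ∀ {M M'} → M ≈m M' → Γ̃ M ≈v Γ̃ M'
      Γ-cong   : ∀ {u w} → u ≈v w → Γ u ≈m Γ w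
      Γ∘Γ̃      : ∀ M → Γ (Γ̃ M) ≈m M
      Γ̃∘Γ      : ∀ u → Γ̃ (Γ u) ≈v u
      Γ̃-+      : ∀ M M' → Γ̃ (M +m M') ≈v (Γ̃ M +v Γ̃ M')
      Γ̃-·      : ∀ a M → Γ̃ (a ·m M) ≈v (a ·v Γ̃ M)

  ιA ιB ιC : Fin D → Fin N
  ιA t = t ↑ˡ (D ℕ.+ (D ℕ.+ 2))
  ιB t = D ↑ʳ (t ↑ˡ (D ℕ.+ 2))
  ιC t = D ↑ʳ (D ↑ʳ (t ↑ˡ 2))

  ii jj : Fin N
  ii = D ↑ʳ (D ↑ʳ (D ↑ʳ Fin.zero))
  jj = D ↑ʳ (D ↑ʳ (D ↑ʳ Fin.suc Fin.zero))

  _[A] _[B] _[C] : Vector Carrier N → Vector Carrier D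
  v [A] = λ t → v (ιA t)
  v [B] = λ t → v (ιB t)
  v [C] = λ t → v (ιC t)

  blocks : Vector Carrier D → Vector Carrier D → Vector Carrier D → Carrier → Carrier → Vector Carrier N
  blocks a b cc x y = a VF.++ (b VF.++ (cc VF.++ (x VF.∷ (y VF.∷ VF.[]))))

  module Setup (A B : Mat) (Γ̃ : Mat → Vector Carrier D) (Γ : Vector Carrier D → Mat) where

    s : Vector Carrier N
    s = blocks (Γ̃ A) (Γ̃ B) 0v 1# 0#

    _⋆_ : Vector Carrier N → Vector Carrier N → Vector Carrier N
    x ⋆ y = blocks 0v 0v
                   ((Γ̃ (Γ (x [C]) ⊗ Γ (y [C])) +v (x jj ·v (y [A]))) +v (y jj ·v (x [B])))
                   0# (x ii *ᵣ y ii)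

    eval : ∀ {n} → Comb n → Vector Carrier N
    eval leaf = s
    eval (node X Y) = eval X ⋆ eval Y

    bar : Vector Carrier N → Vector Carrier D
    bar v = v [C]

    pick : Bool → Mat
    pick true = A
    pick false = B

    prod : ∀ {k} → Vec Bool (suc k) → Mat
    prod (b ∷ []) = pick b
    prod (b ∷ bs@(_ ∷ _)) = pick b ⊗ prod bs

-- A product has zero A-, B- and i-blocks and j-entry x_i y_i, so a value has one of three shapes:
-- s itself, with blocks (Γ̃A, Γ̃B, 0, 1, 0); s * s, with blocks (0, 0, 0, 0, 1); or, from three
-- instances on, a vector supported on R_C.  A nonzero C-block arises only as s * (s * s) = Γ̃B and
-- (s * s) * s = Γ̃A; every other product with s or s * s as a factor has C-block 0, and vectors
-- supported on R_C multiply their C-blocks as matrices.  Hence the C-block of n ≥ 3 instances is 0 or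
-- a word of length n / 3 in A and B, and these two three-instance letters spell every word.
module Submission where

open import Defs
open import Level using (Level)
open import Algebra.Bundles using (CommutativeRing)
open import Data.Nat using (ℕ; suc; _+_; _*_; _≤_; z≤n; s≤s)
import Data.Nat.Properties as ℕ
open import Data.Nat.Divisibility using (_∣_; divides; _∣?_; ∣m+n∣m⇒∣n)
open import Data.Fin using (Fin)
open import Data.Vec using (Vec; []; _∷_; _++_)
open import Data.Vec.Functional using (Vector)
open import Data.Vec.Functional.Properties using (lookup-++ˡ; lookup-++ʳ)
open import Data.Bool using (Bool; true; false)
open import Data.Product using (_×_; Σ; Σ-syntax; _,_; proj₂)
open import Data.Sum using (_⊎_; inj₁; inj₂)
open import Data.Empty using (⊥-elim)
open import Data.Empty.Polymorphic using (⊥)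
open import Relation.Nullary using (¬_)
open import Relation.Nullary.Decidable using (from-no)
import Relation.Binary.PropositionalEquality as ≡

size≥1 : ∀ {n} → Comb n → 1 ≤ n
size≥1 leaf                  = s≤s z≤n
size≥1 (node {n₁} {n₂} X _) = ℕ.≤-trans (size≥1 X) (ℕ.m≤m+n n₁ n₂)

SizeOK-cases : ∀ {n} → 1 ≤ n → SizeOK n → n ≡.≡ 1 ⊎ n ≡.≡ 2 ⊎ 3 ∣ n
SizeOK-cases {1} _ (inj₁ _) = inj₁ ≡.refl
SizeOK-cases {2} _ (inj₁ _) = inj₂ (inj₁ ≡.refl)
SizeOK-cases {suc (suc (suc _))} _ (inj₁ (s≤s (s≤s (s≤s ()))))
SizeOK-cases _ (inj₂ 3∣n) = inj₂ (inj₂ 3∣n)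

Good-node-sizes : ∀ {a b} → 1 ≤ a → 1 ≤ b → SizeOK a → SizeOK b → 3 ∣ a + b →
                  (a ≡.≡ 1 × b ≡.≡ 2) ⊎ (a ≡.≡ 2 × b ≡.≡ 1) ⊎ (3 ∣ a × 3 ∣ b)
Good-node-sizes {a} {b} 1≤a 1≤b okA okB 3∣a+b with SizeOK-cases 1≤a okA | SizeOK-cases 1≤b okB
... | inj₂ (inj₂ 3∣a) | _ = inj₂ (inj₂ (3∣a , ∣m+n∣m⇒∣n 3∣a+b 3∣a))
... | _ | inj₂ (inj₂ 3∣b) =
  inj₂ (inj₂ (∣m+n∣m⇒∣n (≡.subst (3 ∣_) (ℕ.+-comm a b) 3∣a+b) 3∣b , 3∣b))
... | inj₁ ≡.refl | inj₁ ≡.refl = ⊥-elim (from-no (3 ∣? 2) 3∣a+b)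
... | inj₁ ≡.refl | inj₂ (inj₁ ≡.refl) = inj₁ (≡.refl , ≡.refl)
... | inj₂ (inj₁ ≡.refl) | inj₁ ≡.refl = inj₂ (inj₁ (≡.refl , ≡.refl))
... | inj₂ (inj₁ ≡.refl) | inj₂ (inj₁ ≡.refl) = ⊥-elim (from-no (3 ∣? 4) 3∣a+b)

module Proof {c ℓ : Level} (R : CommutativeRing c ℓ) (d : ℕ) where
  open CommutativeRing R renaming (_+_ to _+ᵣ_; _*_ to _*ᵣ_)
  open Construction R d
  open import Algebra.Properties.Semiring.Sum semiring
    using (sum; sum-syntax; sum-cong-≋; sum-cong-≗; sum-replicate-zero; ∑-comm; *-distribˡ-sum; *-distribʳ-sum)
  open import Relation.Binary.Reasoning.Setoid setoid
  open import Data.Vec.Functional.Relation.Binary.Equality.Setoid setoid using (≋-refl)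

  Σ[<]≡sum : ∀ k (f : Fin k → Carrier) → Σ[< k ] f ≡.≡ sum f
  Σ[<]≡sum 0       f = ≡.refl
  Σ[<]≡sum (suc k) f = ≡.cong (f Fin.zero +ᵣ_) (Σ[<]≡sum k (λ i → f (Fin.suc i)))

  0m : Mat
  0m _ _ = 0#

  ⊗≡sum : ∀ M N i j → (M ⊗ N) i j ≡.≡ ∑[ k < d ] (M i k *ᵣ N k j)
  ⊗≡sum M N i j = Σ[<]≡sum d (λ k → M i k *ᵣ N k j)

  ⊗-cong : ∀ {M M' N N'} → M ≈m M' → N ≈m N' → (M ⊗ N) ≈m (M' ⊗ N')
  ⊗-cong {M} {M'} {N} {N'} M≈M' N≈N' i j = begin
    (M ⊗ N) i j                   ≡⟨ ⊗≡sum M N i j ⟩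
    ∑[ k < d ] (M i k *ᵣ N k j)   ≈⟨ sum-cong-≋ (λ k → *-cong (M≈M' i k) (N≈N' k j)) ⟩
    ∑[ k < d ] (M' i k *ᵣ N' k j) ≡⟨ ⊗≡sum M' N' i j ⟨
    (M' ⊗ N') i j                 ∎

  ⊗-zeroˡ : ∀ {M} N → M ≈m 0m → (M ⊗ N) ≈m 0m
  ⊗-zeroˡ {M} N M≈0 i j = begin
    (M ⊗ N) i j                 ≡⟨ ⊗≡sum M N i j ⟩
    ∑[ k < d ] (M i k *ᵣ N k j) ≈⟨ sum-cong-≋ (λ k → trans (*-congʳ (M≈0 i k)) (zeroˡ (N k j))) ⟩
    ∑[ k < d ] 0#               ≈⟨ sum-replicate-zero d ⟩
    0#                          ∎

  ⊗-zeroʳ : ∀ M {N} → N ≈m 0m → (M ⊗ N) ≈m 0m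
  ⊗-zeroʳ M {N} N≈0 i j = begin
    (M ⊗ N) i j                 ≡⟨ ⊗≡sum M N i j ⟩
    ∑[ k < d ] (M i k *ᵣ N k j) ≈⟨ sum-cong-≋ (λ k → trans (*-congˡ (N≈0 k j)) (zeroʳ (M i k))) ⟩
    ∑[ k < d ] 0#               ≈⟨ sum-replicate-zero d ⟩
    0#                          ∎

  ⊗-assoc : ∀ M N P → ((M ⊗ N) ⊗ P) ≈m (M ⊗ (N ⊗ P))
  ⊗-assoc M N P i j = begin
    ((M ⊗ N) ⊗ P) i j
      ≡⟨ ⊗≡sum (M ⊗ N) P i j ⟩
    ∑[ k < d ] ((M ⊗ N) i k *ᵣ P k j)
      ≡⟨ sum-cong-≗ (λ k → ≡.cong (_*ᵣ P k j) (⊗≡sum M N i k)) ⟩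
    ∑[ k < d ] (∑[ l < d ] (M i l *ᵣ N l k) *ᵣ P k j)
      ≈⟨ sum-cong-≋ (λ k → *-distribʳ-sum (P k j) (λ l → M i l *ᵣ N l k)) ⟩
    ∑[ k < d ] ∑[ l < d ] ((M i l *ᵣ N l k) *ᵣ P k j)
      ≈⟨ sum-cong-≋ (λ k → sum-cong-≋ (λ l → *-assoc (M i l) (N l k) (P k j))) ⟩
    ∑[ k < d ] ∑[ l < d ] (M i l *ᵣ (N l k *ᵣ P k j))
      ≈⟨ ∑-comm (λ k l → M i l *ᵣ (N l k *ᵣ P k j)) ⟩
    ∑[ l < d ] ∑[ k < d ] (M i l *ᵣ (N l k *ᵣ P k j))
      ≈⟨ sum-cong-≋ (λ l → *-distribˡ-sum (M i l) (λ k → N l k *ᵣ P k j)) ⟨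
    ∑[ l < d ] (M i l *ᵣ ∑[ k < d ] (N l k *ᵣ P k j))
      ≡⟨ sum-cong-≗ (λ l → ≡.cong (M i l *ᵣ_) (⊗≡sum N P l j)) ⟨
    ∑[ l < d ] (M i l *ᵣ (N ⊗ P) l j)
      ≡⟨ ⊗≡sum M (N ⊗ P) i j ⟨
    (M ⊗ (N ⊗ P)) i j
      ∎

  +-collapse₁ : ∀ {x y z w} → x ≈ w → y ≈ 0# → z ≈ 0# → (x +ᵣ y) +ᵣ z ≈ w
  +-collapse₁ {x} {y} {z} {w} x≈w y≈0 z≈0 = begin
    (x +ᵣ y) +ᵣ z   ≈⟨ +-cong (+-congˡ y≈0) z≈0 ⟩
    (x +ᵣ 0#) +ᵣ 0# ≈⟨ trans (+-identityʳ _) (+-identityʳ x) ⟩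
    x               ≈⟨ x≈w ⟩
    w               ∎

  +-collapse₂ : ∀ {x y z w} → x ≈ 0# → y ≈ w → z ≈ 0# → (x +ᵣ y) +ᵣ z ≈ w
  +-collapse₂ {x} {y} {z} {w} x≈0 y≈w z≈0 = begin
    (x +ᵣ y) +ᵣ z   ≈⟨ +-cong (+-congʳ x≈0) z≈0 ⟩
    (0# +ᵣ y) +ᵣ 0# ≈⟨ trans (+-identityʳ _) (+-identityˡ y) ⟩
    y               ≈⟨ y≈w ⟩
    w               ∎

  +-collapse₃ : ∀ {x y z w} → x ≈ 0# → y ≈ 0# → z ≈ w → (x +ᵣ y) +ᵣ z ≈ w
  +-collapse₃ {x} {y} {z} {w} x≈0 y≈0 z≈w = begin
    (x +ᵣ y) +ᵣ z   ≈⟨ +-congʳ (+-cong x≈0 y≈0) ⟩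
    (0# +ᵣ 0#) +ᵣ z ≈⟨ trans (+-congʳ (+-identityˡ 0#)) (+-identityˡ z) ⟩
    z               ≈⟨ z≈w ⟩
    w               ∎

  record HasBlocks (α β γ : Vector Carrier D) (p q : Carrier) (v : Vector Carrier N) : Set ℓ where
    field
      A-block : (v [A]) ≈v α
      B-block : (v [B]) ≈v β
      C-block : (v [C]) ≈v γ
      i-entry : v ii ≈ p
      j-entry : v jj ≈ q

  open HasBlocks public

  blocks-HasBlocks : ∀ α β γ p q → HasBlocks α β γ p q (blocks α β γ p q)
  blocks-HasBlocks α β γ p q = record
    { A-block = λ t → reflexive (lookup-++ˡ α _ t)
    ; B-block = λ t → reflexive (≡.trans (lookup-++ʳ α _ _) (lookup-++ˡ β _ t))
    ; C-block = λ t → reflexive (≡.trans (lookup-++ʳ α _ _) (≡.trans (lookup-++ʳ β _ _) (lookup-++ˡ γ _ t)))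
    ; i-entry = reflexive (≡.trans (lookup-++ʳ α _ _) (≡.trans (lookup-++ʳ β _ _) (lookup-++ʳ γ _ _)))
    ; j-entry = reflexive (≡.trans (lookup-++ʳ α _ _) (≡.trans (lookup-++ʳ β _ _) (lookup-++ʳ γ _ _)))
    }

  HasBlocks-[C] : ∀ {α β γ p q v} → HasBlocks α β γ p q v → HasBlocks α β (v [C]) p q v
  HasBlocks-[C] h = record
    { A-block = A-block h ; B-block = B-block h ; C-block = λ _ → refl
    ; i-entry = i-entry h ; j-entry = j-entry h }

  module Transport {Γ̃ : Mat → Vector Carrier D} {Γ : Vector Carrier D → Mat}
                   (LB : IsLinearBijection Γ̃ Γ) where
    open IsLinearBijection LB

    Γ̃-zero : ∀ {M} → M ≈m 0m → Γ̃ M ≈v 0v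
    Γ̃-zero {M} M≈0 t = begin
      Γ̃ M t          ≈⟨ Γ̃-cong (λ i j → trans (M≈0 i j) (sym (zeroˡ 0#))) t ⟩
      Γ̃ (0# ·m 0m) t ≈⟨ Γ̃-· 0# 0m t ⟩
      0# *ᵣ Γ̃ 0m t   ≈⟨ zeroˡ _ ⟩
      0#             ∎

    Γ-zero : ∀ {u} → u ≈v 0v → Γ u ≈m 0m
    Γ-zero {u} u≈0 i j = begin
      Γ u i j      ≈⟨ Γ-cong (λ t → trans (u≈0 t) (sym (Γ̃-zero (λ _ _ → refl) t))) i j ⟩
      Γ (Γ̃ 0m) i j ≈⟨ Γ∘Γ̃ 0m i j ⟩
      0#           ∎

    infixl 7 _⊛_
    _⊛_ : Vector Carrier D → Vector Carrier D → Vector Carrier D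
    u ⊛ w = Γ̃ (Γ u ⊗ Γ w)

    ⊛-cong : ∀ {u u' w w'} → u ≈v u' → w ≈v w' → (u ⊛ w) ≈v (u' ⊛ w')
    ⊛-cong u≈u' w≈w' = Γ̃-cong (⊗-cong (Γ-cong u≈u') (Γ-cong w≈w'))

    ⊛-zeroˡ : ∀ {u} w → u ≈v 0v → (u ⊛ w) ≈v 0v
    ⊛-zeroˡ w u≈0 = Γ̃-zero (⊗-zeroˡ (Γ w) (Γ-zero u≈0))

    ⊛-zeroʳ : ∀ u {w} → w ≈v 0v → (u ⊛ w) ≈v 0v
    ⊛-zeroʳ u w≈0 = Γ̃-zero (⊗-zeroʳ (Γ u) (Γ-zero w≈0))

    Γ-⊛ : ∀ u w → Γ (u ⊛ w) ≈m (Γ u ⊗ Γ w)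
    Γ-⊛ u w = Γ∘Γ̃ (Γ u ⊗ Γ w)

    Γ̃-⊛ : ∀ M N → (Γ̃ M ⊛ Γ̃ N) ≈v Γ̃ (M ⊗ N)
    Γ̃-⊛ M N = Γ̃-cong (⊗-cong (Γ∘Γ̃ M) (Γ∘Γ̃ N))

  module Combinations (A B : Mat) (Γ̃ : Mat → Vector Carrier D) (Γ : Vector Carrier D → Mat)
                      (LB : IsLinearBijection Γ̃ Γ) where
    open IsLinearBijection LB
    open Transport LB
    open Setup A B Γ̃ Γ

    IsSingle IsPair : Vector Carrier N → Set ℓ
    IsSingle = HasBlocks (Γ̃ A) (Γ̃ B) 0v 1# 0#
    IsPair   = HasBlocks 0v 0v 0v 0# 1#

    IsCentral : Vector Carrier D → Vector Carrier N → Set ℓ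
    IsCentral γ = HasBlocks 0v 0v γ 0# 0#

    ⋆-HasBlocks : ∀ {α β γ p q α' β' γ' p' q' γ'' q'' x y} →
                  HasBlocks α β γ p q x → HasBlocks α' β' γ' p' q' y →
                  (∀ t → ((γ ⊛ γ') t +ᵣ q *ᵣ α' t) +ᵣ q' *ᵣ β t ≈ γ'' t) → p *ᵣ p' ≈ q'' →
                  HasBlocks 0v 0v γ'' 0# q'' (x ⋆ y)
    ⋆-HasBlocks hx hy C≈ j≈ = record
      { A-block = A-block h
      ; B-block = B-block h
      ; i-entry = i-entry h
      ; C-block = λ t → trans (C-block h t)
          (trans (+-cong (+-cong (⊛-cong (C-block hx) (C-block hy) t)
                                 (*-cong (j-entry hx) (A-block hy t)))
                         (*-cong (j-entry hy) (B-block hx t)))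
                 (C≈ t))
      ; j-entry = trans (j-entry h) (trans (*-cong (i-entry hx) (i-entry hy)) j≈)
      }
      where h = blocks-HasBlocks _ _ _ _ _

    single⋆single : ∀ {x y} → IsSingle x → IsSingle y → IsPair (x ⋆ y)
    single⋆single hx hy =
      ⋆-HasBlocks hx hy (λ t → +-collapse₁ (⊛-zeroˡ 0v ≋-refl t) (zeroˡ _) (zeroˡ _)) (*-identityˡ 1#)

    single⋆pair : ∀ {x y} → IsSingle x → IsPair y → IsCentral (Γ̃ B) (x ⋆ y)
    single⋆pair hx hy =
      ⋆-HasBlocks hx hy (λ t → +-collapse₃ (⊛-zeroˡ 0v ≋-refl t) (zeroˡ 0#) (*-identityˡ _)) (zeroʳ 1#)

    pair⋆single : ∀ {x y} → IsPair x → IsSingle y → IsCentral (Γ̃ A) (x ⋆ y)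
    pair⋆single hx hy =
      ⋆-HasBlocks hx hy (λ t → +-collapse₂ (⊛-zeroˡ 0v ≋-refl t) (*-identityˡ _) (zeroˡ 0#)) (zeroˡ 1#)

    pair⋆pair : ∀ {x y} → IsPair x → IsPair y → IsCentral 0v (x ⋆ y)
    pair⋆pair hx hy =
      ⋆-HasBlocks hx hy (λ t → +-collapse₁ (⊛-zeroˡ 0v ≋-refl t) (zeroʳ 1#) (zeroʳ 1#)) (zeroˡ 0#)

    ⋆-central : ∀ {α β γ p q γ' x y} →
                HasBlocks α β γ p q x → IsCentral γ' y → IsCentral (γ ⊛ γ') (x ⋆ y)
    ⋆-central {q = q} hx hy = ⋆-HasBlocks hx hy (λ t → +-collapse₁ refl (zeroʳ q) (zeroˡ _)) (zeroʳ _)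

    central-⋆ : ∀ {γ α' β' γ' p' q' x y} →
                IsCentral γ x → HasBlocks α' β' γ' p' q' y → IsCentral (γ ⊛ γ') (x ⋆ y)
    central-⋆ {q' = q'} hx hy = ⋆-HasBlocks hx hy (λ t → +-collapse₁ refl (zeroˡ _) (zeroʳ q')) (zeroˡ _)

    -- n counts instances of s: each letter costs three.
    IsWord : ℕ → Mat → Set ℓ
    IsWord n M = Σ[ k ∈ ℕ ] n ≡.≡ 3 * suc k × Σ[ Ms ∈ Vec Bool (suc k) ] M ≈m prod Ms

    NullOrWord : ℕ → Vector Carrier D → Set ℓ
    NullOrWord n γ = γ ≈v 0v ⊎ IsWord n (Γ γ)

    prod-++ : ∀ {k l} (Ms : Vec Bool (suc k)) (Ns : Vec Bool (suc l)) →
              prod (Ms ++ Ns) ≈m (prod Ms ⊗ prod Ns)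
    prod-++ (b ∷ []) (_ ∷ _) i j = refl
    prod-++ (b ∷ Ms@(_ ∷ _)) Ns i j =
      trans (⊗-cong {pick b} (λ _ _ → refl) (prod-++ Ms Ns) i j)
            (sym (⊗-assoc (pick b) (prod Ms) (prod Ns) i j))

    IsWord-resp : ∀ {n M M'} → M' ≈m M → IsWord n M → IsWord n M'
    IsWord-resp M'≈M (k , n≡ , Ms , M≈) = k , n≡ , Ms , λ i j → trans (M'≈M i j) (M≈ i j)

    IsWord-⊗ : ∀ {m n M N} → IsWord m M → IsWord n N → IsWord (m + n) (M ⊗ N)
    IsWord-⊗ (k , ≡.refl , Ms , M≈) (l , ≡.refl , Ns , N≈) =
      k + suc l , ≡.sym (ℕ.*-distribˡ-+ 3 (suc k) (suc l)) , Ms ++ Ns ,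
      λ i j → trans (⊗-cong M≈ N≈ i j) (sym (prod-++ Ms Ns i j))

    IsWord-⊛ : ∀ {m n γ γ'} → IsWord m (Γ γ) → IsWord n (Γ γ') → IsWord (m + n) (Γ (γ ⊛ γ'))
    IsWord-⊛ {γ = γ} {γ'} w w' = IsWord-resp (Γ-⊛ γ γ') (IsWord-⊗ w w')

    IsWord⇒3∣ : ∀ {n M} → IsWord n M → 3 ∣ n
    IsWord⇒3∣ (k , ≡.refl , _) = divides (suc k) (ℕ.*-comm 3 (suc k))

    IsWord-3* : ∀ {k M} → IsWord (3 * suc k) M → Σ[ Ms ∈ Vec Bool (suc k) ] M ≈m prod Ms
    IsWord-3* {k} (l , 3k≡3l , Ms , M≈) with ℕ.suc-injective (ℕ.*-cancelˡ-≡ (suc k) (suc l) 3 3k≡3l)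
    ... | ≡.refl = Ms , M≈

    letter-word : ∀ b → IsWord 3 (Γ (Γ̃ (pick b)))
    letter-word b = 0 , ≡.refl , b ∷ [] , Γ∘Γ̃ (pick b)

    ⊛-NullOrWord : ∀ {m n γ γ'} → NullOrWord m γ → NullOrWord n γ' → NullOrWord (m + n) (γ ⊛ γ')
    ⊛-NullOrWord (inj₁ γ≈0) _ = inj₁ (⊛-zeroˡ _ γ≈0)
    ⊛-NullOrWord (inj₂ _) (inj₁ γ'≈0) = inj₁ (⊛-zeroʳ _ γ'≈0)
    ⊛-NullOrWord (inj₂ w) (inj₂ w') = inj₂ (IsWord-⊛ w w')

    Shape : ℕ → Vector Carrier N → Set ℓ
    Shape 0 _ = ⊥
    Shape 1 = IsSingle
    Shape 2 = IsPair
    Shape n@(suc (suc (suc _))) v = IsCentral (v [C]) v × NullOrWord n (v [C])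

    NullOrWord-resp : ∀ {n γ γ'} → γ' ≈v γ → NullOrWord n γ → NullOrWord n γ'
    NullOrWord-resp γ'≈γ (inj₁ γ≈0) = inj₁ (λ t → trans (γ'≈γ t) (γ≈0 t))
    NullOrWord-resp γ'≈γ (inj₂ w)   = inj₂ (IsWord-resp (Γ-cong γ'≈γ) w)

    central-Shape : ∀ {n γ v} → IsCentral γ v → NullOrWord (3 + n) γ → Shape (3 + n) v
    central-Shape h γ-shape = HasBlocks-[C] h , NullOrWord-resp (C-block h) γ-shape

    ⋆-Shape : ∀ {m n x y} → Shape m x → Shape n y → Shape (m + n) (x ⋆ y)
    ⋆-Shape {0} ()
    ⋆-Shape {_} {0} _ ()
    ⋆-Shape {1} {1} hx hy = single⋆single hx hy
    ⋆-Shape {1} {2} hx hy = central-Shape (single⋆pair hx hy) (inj₂ (letter-word false))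
    ⋆-Shape {1} {suc (suc (suc _))} hx (hy , _) = central-Shape (⋆-central hx hy) (inj₁ (⊛-zeroˡ _ ≋-refl))
    ⋆-Shape {2} {1} hx hy = central-Shape (pair⋆single hx hy) (inj₂ (letter-word true))
    ⋆-Shape {2} {2} hx hy = central-Shape (pair⋆pair hx hy) (inj₁ ≋-refl)
    ⋆-Shape {2} {suc (suc (suc _))} hx (hy , _) = central-Shape (⋆-central hx hy) (inj₁ (⊛-zeroˡ _ ≋-refl))
    ⋆-Shape {suc (suc (suc _))} {1} (hx , _) hy = central-Shape (central-⋆ hx hy) (inj₁ (⊛-zeroʳ _ ≋-refl))
    ⋆-Shape {suc (suc (suc _))} {2} (hx , _) hy = central-Shape (central-⋆ hx hy) (inj₁ (⊛-zeroʳ _ ≋-refl))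
    ⋆-Shape {suc (suc (suc _))} {suc (suc (suc _))} (hx , wx) (hy , wy) =
      central-Shape (central-⋆ hx hy) (⊛-NullOrWord wx wy)

    eval-Shape : ∀ {n} (t : Comb n) → Shape n (eval t)
    eval-Shape leaf       = blocks-HasBlocks _ _ _ _ _
    eval-Shape (node X Y) = ⋆-Shape (eval-Shape X) (eval-Shape Y)

    Shape-≥3 : ∀ {n v} → 3 ≤ n → Shape n v → IsCentral (v [C]) v × NullOrWord n (v [C])
    Shape-≥3 {1} (s≤s ())
    Shape-≥3 {2} (s≤s (s≤s ()))
    Shape-≥3 {suc (suc (suc _))} _ h = h

    Shape-null : ∀ {n v} → ¬ (3 ∣ n) → Shape n v → (v [C]) ≈v 0v
    Shape-null {1} _ h = C-block h
    Shape-null {2} _ h = C-block h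
    Shape-null {suc (suc (suc _))} _ (_ , inj₁ C≈0) = C≈0
    Shape-null {suc (suc (suc _))} 3∤n (_ , inj₂ w) = ⊥-elim (3∤n (IsWord⇒3∣ w))

    bar-eval≈0 : (n : ℕ) (t : Comb n) → ¬ (3 ∣ n) → bar (eval t) ≈v 0v
    bar-eval≈0 n t 3∤n = Shape-null 3∤n (eval-Shape t)

    bar-eval-word : (k : ℕ) (t : Comb (3 * suc k)) → ¬ (bar (eval t) ≈v 0v) →
                    Σ (Vec Bool (suc k)) (λ Ms → Γ (bar (eval t)) ≈m prod Ms)
    bar-eval-word k t C≉0 with Shape-≥3 (ℕ.m≤m*n 3 (suc k)) (eval-Shape t)
    ... | _ , inj₁ C≈0 = ⊥-elim (C≉0 C≈0)
    ... | _ , inj₂ w   = IsWord-3* w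

    letter : Bool → Comb 3
    letter true  = node (node leaf leaf) leaf
    letter false = node leaf (node leaf leaf)

    spell : ∀ {k} → Vec Bool (suc k) → Comb (suc k * 3)
    spell (b ∷ [])           = letter b
    spell (b ∷ bs@(_ ∷ _)) = node (letter b) (spell bs)

    eval-letter : ∀ b → IsCentral (Γ̃ (pick b)) (eval (letter b))
    eval-letter true  = pair⋆single (single⋆single (eval-Shape leaf) (eval-Shape leaf)) (eval-Shape leaf)
    eval-letter false = single⋆pair (eval-Shape leaf) (single⋆single (eval-Shape leaf) (eval-Shape leaf))

    eval-spell : ∀ {k} (Ms : Vec Bool (suc k)) → IsCentral (Γ̃ (prod Ms)) (eval (spell Ms))
    eval-spell (b ∷ [])           = eval-letter b
    eval-spell (b ∷ bs@(_ ∷ _)) =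
      ⋆-HasBlocks (eval-letter b) (eval-spell bs)
        (λ t → +-collapse₁ (Γ̃-⊛ (pick b) (prod bs) t) (zeroˡ _) (zeroʳ 0#)) (zeroˡ 0#)

    spelling : (k : ℕ) (Ms : Vec Bool (suc k)) →
               Σ (Comb (3 * suc k)) (λ t → Γ (bar (eval t)) ≈m prod Ms)
    spelling k Ms = ≡.subst (λ n → Σ (Comb n) (λ t → Γ (bar (eval t)) ≈m prod Ms))
                            (ℕ.*-comm (suc k) 3)
                            (spell Ms , λ i j → trans (Γ-cong (C-block (eval-spell Ms)) i j)
                                                      (Γ∘Γ̃ (prod Ms) i j))

    central-word : ∀ {n γ v} → IsCentral γ v → IsWord n (Γ γ) →
                   IsCentral (v [C]) v × IsWord n (Γ (v [C]))
    central-word h w = HasBlocks-[C] h , IsWord-resp (Γ-cong (C-block h)) w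

    Good-word : ∀ {n} (t : Comb n) → Good t → 3 ∣ n →
                IsCentral (bar (eval t)) (eval t) × IsWord n (Γ (bar (eval t)))
    Good-word leaf _ 3∣1 = ⊥-elim (from-no (3 ∣? 1) 3∣1)
    Good-word (node X Y) (good-node okX okY gX gY) 3∣n
      with Good-node-sizes (size≥1 X) (size≥1 Y) okX okY 3∣n
    ... | inj₁ (≡.refl , ≡.refl) =
      central-word (single⋆pair (eval-Shape X) (eval-Shape Y)) (letter-word false)
    ... | inj₂ (inj₁ (≡.refl , ≡.refl)) =
      central-word (pair⋆single (eval-Shape X) (eval-Shape Y)) (letter-word true)
    ... | inj₂ (inj₂ (3∣a , 3∣b)) with Good-word X gX 3∣a | Good-word Y gY 3∣b
    ... | hX , wX | hY , wY = central-word (central-⋆ hX hY) (IsWord-⊛ wX wY)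

    good-bar-eval-word : (k : ℕ) (t : Comb (3 * suc k)) → Good t →
                         Σ (Vec Bool (suc k)) (λ Ms → Γ (bar (eval t)) ≈m prod Ms)
    good-bar-eval-word k t good =
      IsWord-3* (proj₂ (Good-word t good (divides (suc k) (ℕ.*-comm 3 (suc k)))))

proposition1 : ∀ {c ℓ : Level} (R : CommutativeRing c ℓ) (d : ℕ) →
    let open CommutativeRing R using (Carrier)
        open Construction R d
    in (A B : Mat) (Γ̃ : Mat → Vector Carrier D) (Γ : Vector Carrier D → Mat) →
       IsLinearBijection Γ̃ Γ →
       let open Setup A B Γ̃ Γ
       in ((n : ℕ) (t : Comb n) → ¬ (3 ∣ n) → bar (eval t) ≈v 0v)
        × ((k : ℕ) (t : Comb (3 * suc k)) → ¬ (bar (eval t) ≈v 0v) →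
             Σ (Vec Bool (suc k)) (λ Ms → Γ (bar (eval t)) ≈m prod Ms))
        × ((k : ℕ) (Ms : Vec Bool (suc k)) →
             Σ (Comb (3 * suc k)) (λ t → Γ (bar (eval t)) ≈m prod Ms))
        × ((k : ℕ) (t : Comb (3 * suc k)) → Good t →
             Σ (Vec Bool (suc k)) (λ Ms → Γ (bar (eval t)) ≈m prod Ms))
proposition1 R d A B Γ̃ Γ LB = bar-eval≈0 , bar-eval-word , spelling , good-bar-eval-word
  where open Proof.Combinations R d A B Γ̃ Γ LB
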